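{- Let $T=(V,E)$ be a tree with $|V|\ge 2$. Then the set of center edges of $T$ forms a substar, i.e. all center edges of $T$ share a common vertex.
   Context: For an edge $e=uv$ of a tree $T$, removing $e$ leaves two trees; $V^e_u$ is the vertex set of the one containing $u$ and $V^e_v$ that of the one containing $v$. A center edge is an edge $e=uv$ minimizing $\big||V^e_u|-|V^e_v|\big|$ over all edges of $T$. A substar is a vertex-induced subgraph which is a star, i.e. consists of edges sharing a common vertex. -}

module Defs where

open import Level using (0ℓ)
open import Data.Nat.Base using (ℕ; _≤_; ∣_-_∣)
open import Data.Fin.Base using (Fin)
open import Data.List.Base using (List; []; _∷_; _++_; take; length)
open import Data.List.Relation.Unary.Linked using (Linked)
open import Data.List.Relation.Unary.Unique.Propositional using (Unique)
open import Data.List.Membership.Propositional using (_∈_)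
open import Data.Product.Base using (_×_; ∃; Σ)
open import Data.Sum.Base using (_⊎_)
open import Data.Empty using (⊥)
open import Relation.Nullary using (¬_)
open import Relation.Binary.PropositionalEquality using (_≡_)
open import Function.Bundles using (_⇔_)

record Graph (n : ℕ) : Set₁ where
  field
    Adj     : Fin n → Fin n → Set
    sym     : ∀ {x y} → Adj x y → Adj y x
    irrefl  : ∀ {x} → ¬ Adj x x
open Graph public

data Reach {n : ℕ} (R : Fin n → Fin n → Set) : Fin n → Fin n → Set where
  here  : ∀ {x} → Reach R x x
  there : ∀ {x y z} → R x y → Reach R y z → Reach R x z

Connected : ∀ {n} → Graph n → Set
Connected G = ∀ x y → Reach (Adj G) x y

-- A cycle: a list of at least 3 distinct vertices, consecutive ones adjacent,
-- and the last adjacent to the first.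
IsCycle : ∀ {n} → Graph n → List (Fin n) → Set
IsCycle G cs = (3 ≤ length cs) × Unique cs × Linked (Adj G) (cs ++ take 1 cs)

Acyclic : ∀ {n} → Graph n → Set
Acyclic G = ∀ cs → ¬ IsCycle G cs

IsTree : ∀ {n} → Graph n → Set
IsTree G = Connected G × Acyclic G

SameEdge : ∀ {n} → Fin n → Fin n → Fin n → Fin n → Set
SameEdge x y u v = (x ≡ u × y ≡ v) ⊎ (x ≡ v × y ≡ u)

AdjMinus : ∀ {n} → Graph n → Fin n → Fin n → Fin n → Fin n → Set
AdjMinus G u v x y = Adj G x y × ¬ SameEdge x y u v

HasSize : ∀ {n} → (Fin n → Set) → ℕ → Set
HasSize {n} P k = Σ (List (Fin n)) λ xs →
  Unique xs × (∀ x → (x ∈ xs) ⇔ P x) × length xs ≡ k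

-- V^e_u for e = uv: vertices of the component of T - e containing u.
V^ : ∀ {n} → Graph n → (u v : Fin n) → Fin n → Set
V^ G u v w = Reach (AdjMinus G u v) u w

EdgeSizes : ∀ {n} → Graph n → (u v : Fin n) → ℕ → ℕ → Set
EdgeSizes G u v a b = HasSize (V^ G u v) a × HasSize (V^ G v u) b

IsCenterEdge : ∀ {n} → Graph n → Fin n → Fin n → Set
IsCenterEdge G u v =
  Adj G u v ×
  (∀ a b → EdgeSizes G u v a b →
     ∀ u' v' → Adj G u' v' → ∀ a' b' → EdgeSizes G u' v' a' b' →
     ∣ a - b ∣ ≤ ∣ a' - b' ∣)

{-# OPTIONS --safe #-}
-- Two disjoint center edges cannot exist. Orient them so that they face each
-- other, u₁v₁ ⋯ u₂v₂, and let v₁x be the first edge of the path from v₁ to u₂.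
-- The sides of v₁x are strictly nested between the corresponding sides of
-- u₁v₁ and of u₂v₂, which forces the size difference at v₁x below that of one
-- of them. So the center edges pairwise intersect, and pairwise intersecting
-- edges of a triangle-free graph share a vertex.
module Submission where

open import Defs hiding (sym)
open import Level using (0ℓ)
open import Data.Nat.Base using (ℕ; suc; _≤_; _<_; _∸_; z≤n; s≤s; ∣_-_∣)
open import Data.Nat.Properties
  using (_≤?_; ≤-total; <⇒≤; <⇒≱; m≤n⇒m≤1+n; m<n⇒m<1+n;
         ∣-∣-comm; m≤n⇒∣m-n∣≡n∸m; m≤n⇒∣n-m∣≡n∸m; ∸-monoˡ-<; ∸-monoʳ-≤; module ≤-Reasoning)
open import Data.Fin.Base using (Fin; zero; suc)
open import Data.Fin.Properties using (_≟_; any?; all?)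
open import Data.Product.Base using (∃; Σ; _×_; _,_; proj₁; proj₂; map₂)
open import Data.Sum.Base using (_⊎_; inj₁; inj₂; [_,_]′)
open import Data.Empty using (⊥; ⊥-elim)
open import Function.Base using (_∘_)
open import Relation.Nullary using (¬_; Dec; yes; no; contradiction)
open import Relation.Nullary.Decidable using (_×-dec_; _→-dec_; _⊎-dec_; ¬?; decidable-stable)
open import Relation.Unary using (Pred; Decidable; _⊆_)
open import Relation.Binary.PropositionalEquality
  using (_≡_; _≢_; refl; sym; subst; ≢-sym)
open import Data.List.Base using (List; []; _∷_; _++_; length; filter; allFin)
open import Data.List.Relation.Unary.Any using (here; there)
open import Data.List.Relation.Unary.All using (All; []; _∷_; lookup)
open import Data.List.Relation.Unary.All.Properties using (¬Any⇒All¬)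
open import Data.List.Relation.Unary.Linked using (Linked; []; [-]; _∷_)
open import Data.List.Relation.Unary.AllPairs using ([]; _∷_)
open import Data.List.Relation.Unary.Unique.Propositional using (Unique)
open import Data.List.Relation.Unary.Unique.Propositional.Properties using (filter⁺; allFin⁺)
open import Data.List.Membership.Propositional using (_∈_)
open import Data.List.Membership.Propositional.Properties using (∈-filter⁺; ∈-filter⁻; ∈-allFin)
open import Function.Bundles using (mk⇔)

Incident : ∀ {n} → Fin n → Fin n → Fin n → Set
Incident w u v = u ≡ w ⊎ v ≡ w

incident? : ∀ {n} (w u v : Fin n) → Dec (Incident w u v)
incident? w u v = (u ≟ w) ⊎-dec (v ≟ w)

Incident⇒≡ˡ : ∀ {n} {w a b : Fin n} → Incident w a b → w ≢ b → w ≡ a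
Incident⇒≡ˡ (inj₁ a≡w) _ = sym a≡w
Incident⇒≡ˡ (inj₂ b≡w) w≢b = contradiction (sym b≡w) w≢b

Incident⇒≡ʳ : ∀ {n} {w a b : Fin n} → Incident w a b → w ≢ a → w ≡ b
Incident⇒≡ʳ (inj₁ a≡w) w≢a = contradiction (sym a≡w) w≢a
Incident⇒≡ʳ (inj₂ b≡w) _ = sym b≡w

PairwiseIntersecting : ∀ {n} → (Fin n → Fin n → Set) → Set
PairwiseIntersecting C =
  ∀ {p q r s} → C p q → C r s → ∃ λ w → Incident w p q × Incident w r s

Star : ∀ {n} → (Fin n → Fin n → Set) → Fin n → Set
Star C w = ∀ u v → C u v → Incident w u v

TriangleFree : ∀ {n} → Graph n → Set
TriangleFree G = ∀ {x y z} → Adj G x y → Adj G y z → Adj G z x → ⊥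

module _ {n} (G : Graph n) where

  adj⇒≢ : ∀ {x y} → Adj G x y → x ≢ y
  adj⇒≢ e refl = irrefl G e

  acyclic⇒triangleFree : Acyclic G → TriangleFree G
  acyclic⇒triangleFree acyc {x} {y} {z} xy yz zx =
    acyc _ (s≤s (s≤s (s≤s z≤n)) , distinct , xy ∷ yz ∷ zx ∷ [-])
    where
    distinct : Unique (x ∷ y ∷ z ∷ [])
    distinct = (adj⇒≢ xy ∷ ≢-sym (adj⇒≢ zx) ∷ []) ∷ (adj⇒≢ yz ∷ []) ∷ [] ∷ []

  incident⇒adjacent : ∀ {u v a b} → Adj G u v → Incident a u v → Incident b u v →
                      a ≢ b → Adj G a b
  incident⇒adjacent e (inj₁ refl) (inj₁ refl) a≢b = contradiction refl a≢b
  incident⇒adjacent e (inj₁ refl) (inj₂ refl) a≢b = e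
  incident⇒adjacent e (inj₂ refl) (inj₁ refl) a≢b = Graph.sym G e
  incident⇒adjacent e (inj₂ refl) (inj₂ refl) a≢b = contradiction refl a≢b

  -- If some C-edge u₁v₁ misses u₀, it passes through v₀; an edge through
  -- neither v₀ nor u₀ would then close a triangle with u₀v₀ and u₁v₁.
  intersecting⇒star : TriangleFree G → {C : Fin n → Fin n → Set} →
                      (∀ u v → Dec (C u v)) → (∀ {u v} → C u v → Adj G u v) →
                      PairwiseIntersecting C → Fin n → ∃ (Star C)
  intersecting⇒star triangleFree {C} C? C⇒Adj meet w₀
    with any? (λ u → any? (C? u))
  ... | no noEdge = w₀ , λ u v c → contradiction (u , v , c) noEdge
  ... | yes (u₀ , v₀ , c₀)
    with any? (λ u → any? (λ v → C? u v ×-dec ¬? (incident? u₀ u v)))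
  ... | no allAtU₀ = u₀ , λ u v c →
          decidable-stable (incident? u₀ u v) (λ ¬i → allAtU₀ (u , v , c , ¬i))
  ... | yes (u₁ , v₁ , c₁ , u₀∉e₁) = v₀ , λ u v c →
          decidable-stable (incident? v₀ u v) (triangle c)
    where
    moveTo : ∀ {w w' u v} → w ≡ w' → Incident w u v → Incident w' u v
    moveTo refl i = i

    excluded : ∀ {w u v w'} → ¬ Incident w' u v → Incident w u v → w ≢ w'
    excluded ¬i i w≡w' = ¬i (moveTo w≡w' i)

    v₀∈e₁ : Incident v₀ u₁ v₁
    v₀∈e₁ with meet c₀ c₁
    ... | w , w∈e₀ , w∈e₁ =
      moveTo (Incident⇒≡ʳ w∈e₀ (excluded u₀∉e₁ w∈e₁)) w∈e₁

    triangle : ∀ {u v} → C u v → ¬ Incident v₀ u v → ⊥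
    triangle {u} {v} c v₀∉e with meet c₀ c | meet c₁ c
    ... | w , w∈e₀ , w∈e | w' , w'∈e₁ , w'∈e =
      triangleFree (C⇒Adj c₀)
        (incident⇒adjacent (C⇒Adj c₁) v₀∈e₁ w'∈e₁ (≢-sym (excluded v₀∉e w'∈e)))
        (incident⇒adjacent (C⇒Adj c) w'∈e u₀∈e (excluded u₀∉e₁ w'∈e₁))
      where
      u₀∈e : Incident u₀ u v
      u₀∈e = moveTo (Incident⇒≡ˡ w∈e₀ (excluded v₀∉e w∈e)) w∈e

module _ {A : Set} {P Q : Pred A 0ℓ} (P? : Decidable P) (Q? : Decidable Q) (P⊆Q : P ⊆ Q) where

  length-filter-≤ : ∀ xs → length (filter P? xs) ≤ length (filter Q? xs)
  length-filter-≤ [] = z≤n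
  length-filter-≤ (x ∷ xs) with P? x | Q? x
  ... | yes _  | yes _  = s≤s (length-filter-≤ xs)
  ... | yes px | no ¬qx = contradiction (P⊆Q px) ¬qx
  ... | no _   | yes _  = m≤n⇒m≤1+n (length-filter-≤ xs)
  ... | no _   | no _   = length-filter-≤ xs

  length-filter-< : ∀ {xs y} → y ∈ xs → Q y → ¬ P y →
                    length (filter P? xs) < length (filter Q? xs)
  length-filter-< {x ∷ xs} (here refl) qy ¬py with P? x | Q? x
  ... | yes py | _      = contradiction py ¬py
  ... | no _   | yes _  = s≤s (length-filter-≤ xs)
  ... | no _   | no ¬qy = contradiction qy ¬qy
  length-filter-< {x ∷ xs} (there y∈xs) qy ¬py with P? x | Q? x
  ... | yes _  | yes _  = s≤s (length-filter-< y∈xs qy ¬py)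
  ... | yes px | no ¬qx = contradiction (P⊆Q px) ¬qx
  ... | no _   | yes _  = m<n⇒m<1+n (length-filter-< y∈xs qy ¬py)
  ... | no _   | no _   = length-filter-< y∈xs qy ¬py

∣-∣-middle-< : ∀ {a₁ b₁ a b a₂ b₂} → a₁ < a → b < b₁ → a < a₂ → b₂ < b →
               ∣ a - b ∣ < ∣ a₁ - b₁ ∣ ⊎ ∣ a - b ∣ < ∣ a₂ - b₂ ∣
∣-∣-middle-< {a₁} {b₁} {a} {b} {a₂} {b₂} a₁<a b<b₁ a<a₂ b₂<b with ≤-total a b
... | inj₁ a≤b = inj₁ (begin-strict
  ∣ a - b ∣    ≡⟨ m≤n⇒∣m-n∣≡n∸m a≤b ⟩
  b ∸ a        <⟨ ∸-monoˡ-< b<b₁ a≤b ⟩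
  b₁ ∸ a       ≤⟨ ∸-monoʳ-≤ b₁ (<⇒≤ a₁<a) ⟩
  b₁ ∸ a₁      ≡⟨ sym (m≤n⇒∣m-n∣≡n∸m a₁≤b₁) ⟩
  ∣ a₁ - b₁ ∣  ∎)
  where
  open ≤-Reasoning
  a₁≤b₁ : a₁ ≤ b₁
  a₁≤b₁ = begin a₁ ≤⟨ <⇒≤ a₁<a ⟩ a ≤⟨ a≤b ⟩ b ≤⟨ <⇒≤ b<b₁ ⟩ b₁ ∎
... | inj₂ b≤a = inj₂ (begin-strict
  ∣ a - b ∣    ≡⟨ m≤n⇒∣n-m∣≡n∸m b≤a ⟩
  a ∸ b        <⟨ ∸-monoˡ-< a<a₂ b≤a ⟩
  a₂ ∸ b       ≤⟨ ∸-monoʳ-≤ a₂ (<⇒≤ b₂<b) ⟩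
  a₂ ∸ b₂      ≡⟨ sym (m≤n⇒∣n-m∣≡n∸m b₂≤a₂) ⟩
  ∣ a₂ - b₂ ∣  ∎)
  where
  open ≤-Reasoning
  b₂≤a₂ : b₂ ≤ a₂
  b₂≤a₂ = begin b₂ ≤⟨ <⇒≤ b₂<b ⟩ b ≤⟨ b≤a ⟩ a ≤⟨ <⇒≤ a<a₂ ⟩ a₂ ∎

Reach-map : ∀ {n} {R S : Fin n → Fin n → Set} → (∀ {a b} → R a b → S a b) →
            ∀ {x y} → Reach R x y → Reach S x y
Reach-map f here = here
Reach-map f (there r w) = there (f r) (Reach-map f w)

module Walk {n : ℕ} {R : Fin n → Fin n → Set} where
  open import Data.List.Membership.DecPropositional (_≟_ {n}) using (_∈?_)

  _▻_ : ∀ {x y z} → Reach R x y → R y z → Reach R x z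
  here ▻ r = there r here
  there r' w ▻ r = there r' (w ▻ r)

  _◅◅_ : ∀ {x y z} → Reach R x y → Reach R y z → Reach R x z
  here ◅◅ w' = w'
  there r w ◅◅ w' = there r (w ◅◅ w')

  reverse : (∀ {a b} → R a b → R b a) → ∀ {x y} → Reach R x y → Reach R y x
  reverse R-sym here = here
  reverse R-sym (there r w) = reverse R-sym w ▻ R-sym r

  vertices : ∀ {x y} → Reach R x y → List (Fin n)
  vertices {x} here = x ∷ []
  vertices {x} (there r w) = x ∷ vertices w

  head∈vertices : ∀ {x y} (w : Reach R x y) → x ∈ vertices w
  head∈vertices here = here refl
  head∈vertices (there r w) = here refl

  1≤length-vertices : ∀ {x y} (w : Reach R x y) → 1 ≤ length (vertices w)
  1≤length-vertices here = s≤s z≤n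
  1≤length-vertices (there r w) = s≤s z≤n

  Path : Fin n → Fin n → Set
  Path x y = Σ (Reach R x y) (Unique ∘ vertices)

  path-from : ∀ {x y c} (w : Reach R x y) → c ∈ vertices w → Unique (vertices w) → Path c y
  path-from here (here refl) unique = here , unique
  path-from (there r w) (here refl) unique = there r w , unique
  path-from (there r w) (there c∈w) (_ ∷ unique) = path-from w c∈w unique

  simplify : ∀ {x y} → Reach R x y → Path x y
  simplify here = here , [] ∷ []
  simplify {x} (there r w) with simplify w
  ... | w' , unique with x ∈? vertices w'
  ...   | yes x∈w' = path-from w' x∈w' unique
  ...   | no x∉w' = there r w' , ¬Any⇒All¬ _ x∉w' ∷ unique

open Walk

module _ {n : ℕ} where

  sameEdge? : ∀ (x y u v : Fin n) → Dec (SameEdge x y u v)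
  sameEdge? x y u v = ((x ≟ u) ×-dec (y ≟ v)) ⊎-dec ((x ≟ v) ×-dec (y ≟ u))

  SameEdge-swap : ∀ {x y u v : Fin n} → SameEdge y x u v → SameEdge x y u v
  SameEdge-swap (inj₁ (y≡u , x≡v)) = inj₂ (x≡v , y≡u)
  SameEdge-swap (inj₂ (y≡v , x≡u)) = inj₁ (x≡u , y≡v)

  SameEdge-flip : ∀ {x y u v : Fin n} → SameEdge x y v u → SameEdge x y u v
  SameEdge-flip (inj₁ p) = inj₂ p
  SameEdge-flip (inj₂ p) = inj₁ p

  ¬SameEdge-tail : ∀ {x y u v : Fin n} → x ≢ u → x ≢ v → ¬ SameEdge x y u v
  ¬SameEdge-tail x≢u x≢v (inj₁ (x≡u , _)) = x≢u x≡u
  ¬SameEdge-tail x≢u x≢v (inj₂ (x≡v , _)) = x≢v x≡v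

  ¬SameEdgeˡ : ∀ {x y u v : Fin n} → x ≢ u → y ≢ u → ¬ SameEdge x y u v
  ¬SameEdgeˡ x≢u y≢u (inj₁ (x≡u , _)) = x≢u x≡u
  ¬SameEdgeˡ x≢u y≢u (inj₂ (_ , y≡u)) = y≢u y≡u

  ¬SameEdgeʳ : ∀ {x y u v : Fin n} → x ≢ v → y ≢ v → ¬ SameEdge x y u v
  ¬SameEdgeʳ x≢v y≢v (inj₁ (_ , y≡v)) = y≢v y≡v
  ¬SameEdgeʳ x≢v y≢v (inj₂ (x≡v , _)) = x≢v x≡v

module Tree {n} (T : Graph n) (connected : Connected T) (acyclic : Acyclic T) where

  infix 4 _~_
  _~_ : Fin n → Fin n → Set
  _~_ = Adj T

  ~-sym : ∀ {x y} → x ~ y → y ~ x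
  ~-sym = Graph.sym T

  AdjMinus-sym : ∀ {u v x y} → AdjMinus T u v x y → AdjMinus T u v y x
  AdjMinus-sym (x~y , ¬uv) = ~-sym x~y , ¬uv ∘ SameEdge-swap

  AdjMinus-flip : ∀ {u v x y} → AdjMinus T v u x y → AdjMinus T u v x y
  AdjMinus-flip (x~y , ¬vu) = x~y , ¬vu ∘ SameEdge-flip

  vertices-linked : ∀ {R} → (∀ {a b} → R a b → a ~ b) →
                    ∀ {x y z} (w : Reach R x y) → y ~ z → Linked _~_ (vertices w ++ z ∷ [])
  vertices-linked f here y~z = y~z ∷ [-]
  vertices-linked f (there r here) y~z = f r ∷ y~z ∷ [-]
  vertices-linked f (there r (there r' w)) y~z = f r ∷ vertices-linked f (there r' w) y~z

  long-path⇒¬closing-edge : ∀ {R} → (∀ {a b} → R a b → a ~ b) →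
    ∀ {x c d y} (r : R x c) (r' : R c d) (w : Reach R d y) →
    Unique (vertices (there r (there r' w))) → ¬ y ~ x
  long-path⇒¬closing-edge f r r' w unique y~x = acyclic _
    (s≤s (s≤s (1≤length-vertices w)) , unique , vertices-linked f (there r (there r' w)) y~x)

  edge-is-bridge : ∀ {u v} → u ~ v → ¬ Reach (AdjMinus T u v) u v
  edge-is-bridge {u} {v} u~v = no-path ∘ simplify
    where
    no-path : ¬ Path u v
    no-path (here , _) = irrefl T u~v
    no-path (there (_ , ¬uv) here , _) = ¬uv (inj₁ (refl , refl))
    no-path (there r (there r' w) , unique) =
      long-path⇒¬closing-edge proj₁ r r' w unique (~-sym u~v)

  adjacent? : ∀ u v → Dec (u ~ v)
  adjacent? u v = decide (simplify (connected u v))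
    where
    decide : ∀ {x y} → Path x y → Dec (x ~ y)
    decide (here , _) = no (irrefl T)
    decide (there x~y here , _) = yes x~y
    decide (there r (there r' w) , unique) =
      no (long-path⇒¬closing-edge (λ e → e) r r' w unique ∘ ~-sym)

  sides-disjoint : ∀ {u v w} → u ~ v → V^ T u v w → V^ T v u w → ⊥
  sides-disjoint u~v p q =
    edge-is-bridge u~v (p ◅◅ reverse AdjMinus-sym (Reach-map AdjMinus-flip q))

  sides-cover : ∀ {u v} → u ~ v → ∀ w → V^ T u v w ⊎ V^ T v u w
  sides-cover {u} {v} u~v w = go (inj₁ here) (connected u w)
    where
    go : ∀ {c} → V^ T u v c ⊎ V^ T v u c → Reach _~_ c w → V^ T u v w ⊎ V^ T v u w
    go side here = side
    go {c} side (there {y = c'} c~c' walk) with sameEdge? c c' u v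
    ... | yes (inj₁ (_ , c'≡v)) = go (inj₂ (subst (V^ T v u) (sym c'≡v) here)) walk
    ... | yes (inj₂ (_ , c'≡u)) = go (inj₁ (subst (V^ T u v) (sym c'≡u) here)) walk
    ... | no ¬uv = go (extend side) walk
      where
      extend : V^ T u v c ⊎ V^ T v u c → V^ T u v c' ⊎ V^ T v u c'
      extend (inj₁ p) = inj₁ (p ▻ (c~c' , ¬uv))
      extend (inj₂ p) = inj₂ (p ▻ (c~c' , ¬uv ∘ SameEdge-flip))

  V^-of-non-edge : ∀ {u v w} → ¬ u ~ v → V^ T u v w
  V^-of-non-edge {u} {v} {w} ¬u~v = Reach-map avoid (connected u w)
    where
    avoid : ∀ {a b} → a ~ b → AdjMinus T u v a b
    avoid a~b = a~b , λ { (inj₁ (refl , refl)) → ¬u~v a~b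
                        ; (inj₂ (refl , refl)) → ¬u~v (~-sym a~b) }

  V^? : ∀ u v → Decidable (V^ T u v)
  V^? u v w with adjacent? u v
  ... | no ¬u~v = yes (V^-of-non-edge ¬u~v)
  ... | yes u~v = [ yes , (λ q → no λ p → sides-disjoint u~v p q) ]′ (sides-cover u~v w)

  avoiding : ∀ {R} → (∀ {a b} → R a b → a ~ b) → ∀ {u v a b} (w : Reach R a b) →
             All (v ≢_) (vertices w) → Reach (AdjMinus T u v) a b
  avoiding f here _ = here
  avoiding f (there r w) (v≢a ∷ v∉w) =
    there (f r , ¬SameEdgeʳ (≢-sym v≢a) (≢-sym (lookup v∉w (head∈vertices w))))
          (avoiding f w v∉w)

  towards : ∀ {u v t} → V^ T v u t → t ≢ v → ∃ λ x → v ~ x × x ≢ u × V^ T x v t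
  towards {u} {v} {t} p t≢v = first-step (simplify p)
    where
    first-step : Path v t → ∃ λ x → v ~ x × x ≢ u × V^ T x v t
    first-step (here , _) = contradiction refl t≢v
    first-step (there (v~x , ¬vu) w , v∉w ∷ _) =
      _ , v~x , (λ x≡u → ¬vu (inj₁ (refl , x≡u))) , avoiding proj₁ w v∉w

  V^-⊆ : ∀ {a b x y} → V^ T a b x → ¬ (V^ T x y a × V^ T x y b) → V^ T x y ⊆ V^ T a b
  V^-⊆ {a} {b} {x} {y} x∈ab ¬ab∈xy = go here x∈ab
    where
    go : ∀ {c w} → V^ T x y c → V^ T a b c → Reach (AdjMinus T x y) c w → V^ T a b w
    go _ c∈ab here = c∈ab
    go {c} c∈xy c∈ab (there {y = c'} r walk) with sameEdge? c c' a b
    ... | yes (inj₁ (c≡a , c'≡b)) =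
      contradiction (subst (V^ T x y) c≡a c∈xy , subst (V^ T x y) c'≡b (c∈xy ▻ r)) ¬ab∈xy
    ... | yes (inj₂ (c≡b , c'≡a)) =
      contradiction (subst (V^ T x y) c'≡a (c∈xy ▻ r) , subst (V^ T x y) c≡b c∈xy) ¬ab∈xy
    ... | no ¬ab = go (c∈xy ▻ r) (c∈ab ▻ (proj₁ r , ¬ab)) walk

  size : Fin n → Fin n → ℕ
  size u v = length (filter (V^? u v) (allFin n))

  size-correct : ∀ u v → HasSize (V^ T u v) (size u v)
  size-correct u v =
    filter (V^? u v) (allFin n) , filter⁺ (V^? u v) (allFin⁺ n) ,
    (λ w → mk⇔ (proj₂ ∘ ∈-filter⁻ (V^? u v) {xs = allFin n}) (∈-filter⁺ (V^? u v) (∈-allFin w))) , refl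

  size-< : ∀ {a b x y} → x ~ y → V^ T a b x → ¬ (V^ T x y a × V^ T x y b) → V^ T a b y →
           size x y < size a b
  size-< x~y x∈ab ¬ab∈xy y∈ab = length-filter-< (V^? _ _) (V^? _ _) (V^-⊆ x∈ab ¬ab∈xy)
    (∈-allFin _) y∈ab (edge-is-bridge x~y)

  gap : Fin n → Fin n → ℕ
  gap u v = ∣ size u v - size v u ∣

  Central : Fin n → Fin n → Set
  Central u v = u ~ v × (∀ u' v' → u' ~ v' → gap u v ≤ gap u' v')

  central? : ∀ u v → Dec (Central u v)
  central? u v = adjacent? u v ×-dec
    all? (λ u' → all? (λ v' → adjacent? u' v' →-dec (gap u v ≤? gap u' v')))

  Central-sym : ∀ {u v} → Central u v → Central v u
  Central-sym {u} {v} (u~v , minimal) = ~-sym u~v , λ u' v' e →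
    subst (_≤ gap u' v') (∣-∣-comm (size u v) (size v u)) (minimal u' v' e)

  isCenterEdge⇒central : ∀ {u v} → IsCenterEdge T u v → Central u v
  isCenterEdge⇒central {u} {v} (u~v , minimal) = u~v , λ u' v' e →
    minimal _ _ (size-correct u v , size-correct v u) u' v' e _ _
            (size-correct u' v' , size-correct v' u')

  -- x is the neighbour of v₁ towards u₂.
  facing-edges-not-central : ∀ {u₁ v₁ u₂ v₂} → v₁ ≢ u₂ → v₁ ≢ v₂ →
    V^ T v₁ u₁ u₂ → V^ T u₂ v₂ v₁ → Central u₁ v₁ → Central u₂ v₂ → ⊥
  facing-edges-not-central {u₁} {v₁} {u₂} {v₂} v₁≢u₂ v₁≢v₂ u₂∈ v₁∈ (e₁ , min₁) (e₂ , min₂)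
    with towards u₂∈ (≢-sym v₁≢u₂)
  ... | x , v₁~x , x≢u₁ , u₂∈ˣ =
    [ (λ lt → <⇒≱ lt (min₁ v₁ x v₁~x)) , (λ lt → <⇒≱ lt (min₂ v₁ x v₁~x)) ]′
      (∣-∣-middle-< near₁ far₁ near₂ far₂)
    where
    u₁≢x : u₁ ≢ x
    u₁≢x = ≢-sym x≢u₁
    near₁ : size u₁ v₁ < size v₁ x
    near₁ = size-< e₁ (there (~-sym e₁ , ¬SameEdgeʳ (adj⇒≢ T v₁~x) u₁≢x) here)
                   (edge-is-bridge e₁ ∘ proj₁) here
    far₁ : size x v₁ < size v₁ u₁
    far₁ = size-< (~-sym v₁~x) (there (v₁~x , ¬SameEdgeʳ (≢-sym (adj⇒≢ T e₁)) x≢u₁) here)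
                  (edge-is-bridge (~-sym v₁~x) ∘ proj₁) here
    near₂ : size v₁ x < size u₂ v₂
    near₂ = size-< v₁~x v₁∈ (λ p → sides-disjoint v₁~x (proj₁ p) u₂∈ˣ)
                   (v₁∈ ▻ (v₁~x , ¬SameEdge-tail v₁≢u₂ v₁≢v₂))
    far₂ : size v₂ u₂ < size x v₁
    far₂ = size-< (~-sym e₂) (u₂∈ˣ ▻ (e₂ , ¬SameEdgeʳ (≢-sym v₁≢u₂) (≢-sym v₁≢v₂)))
                  (λ p → sides-disjoint e₂ v₁∈ (proj₂ p)) u₂∈ˣ

  no-central-edge-beyond : ∀ {u₁ v₁ r s} → Central u₁ v₁ → Central r s → v₁ ≢ r → v₁ ≢ s →
                           V^ T v₁ u₁ r → ⊥
  no-central-edge-beyond c₁ c₂@(r~s , _) v₁≢r v₁≢s r∈ with sides-cover r~s _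
  ... | inj₁ v₁∈r = facing-edges-not-central v₁≢r v₁≢s r∈ v₁∈r c₁ c₂
  ... | inj₂ v₁∈s = facing-edges-not-central v₁≢s v₁≢r
        (r∈ ▻ (r~s , ¬SameEdgeˡ (≢-sym v₁≢r) (≢-sym v₁≢s))) v₁∈s c₁ (Central-sym c₂)

  disjoint-edges-not-central : ∀ {p q r s} → Central p q → Central r s →
                               p ≢ r → p ≢ s → q ≢ r → q ≢ s → ⊥
  disjoint-edges-not-central c₁ c₂ p≢r p≢s q≢r q≢s with sides-cover (proj₁ c₁) _
  ... | inj₁ r∈p = no-central-edge-beyond (Central-sym c₁) c₂ p≢r p≢s r∈p
  ... | inj₂ r∈q = no-central-edge-beyond c₁ c₂ q≢r q≢s r∈q

  central-edges-intersect : PairwiseIntersecting Central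
  central-edges-intersect {p} {q} {r} {s} c₁ c₂ with p ≟ r | p ≟ s | q ≟ r | q ≟ s
  ... | yes p≡r | _       | _       | _       = p , inj₁ refl , inj₁ (sym p≡r)
  ... | no _    | yes p≡s | _       | _       = p , inj₁ refl , inj₂ (sym p≡s)
  ... | no _    | no _    | yes q≡r | _       = q , inj₂ refl , inj₁ (sym q≡r)
  ... | no _    | no _    | no _    | yes q≡s = q , inj₂ refl , inj₂ (sym q≡s)
  ... | no p≢r  | no p≢s  | no q≢r  | no q≢s  =
    ⊥-elim (disjoint-edges-not-central c₁ c₂ p≢r p≢s q≢r q≢s)

corollary5p2 : ∀ {n} (T : Graph n) → 2 ≤ n → IsTree T →
    ∃ λ (w : Fin n) → ∀ u v → IsCenterEdge T u v → (u ≡ w ⊎ v ≡ w)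
corollary5p2 {suc _} T _ (connected , acyclic) =
  map₂ (λ star u v → star u v ∘ isCenterEdge⇒central)
       (intersecting⇒star T (acyclic⇒triangleFree T acyclic) central? proj₁
                          central-edges-intersect zero)
  where open Tree T connected acyclic
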